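{- For every even positive integer $t$, there exists a simple graph that is properly edge-colored with $t+1$ colors such that each color class contains exactly $t$ edges, but the graph has no rainbow matching of size $t$.
   Context: A proper edge-coloring is one in which no two edges sharing a vertex receive the same color. A matching is a set of pairwise vertex-disjoint edges; it is rainbow if its edges have pairwise distinct colors. -}

module Defs where

open import Data.Nat using (ℕ; suc)
open import Data.Fin using (Fin; _<_; _≟_)
open import Data.Product using (_×_; _,_; proj₁; proj₂; Σ; ∃)
open import Data.Vec.Base using (count; tabulate)
open import Relation.Binary.PropositionalEquality using (_≡_; _≢_)
open import Relation.Nullary using (¬_)
open import Function.Definitions using (Injective)

-- Each edge is a pair (u , v) with u < v
-- (so no loops, and each unordered pair has a unique representation),
-- and the edge map is injective (no multiple edges).
record SimpleGraph : Set where
  field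
    n    : ℕ
    m    : ℕ
    edge : Fin m → Fin n × Fin n
    edge-ordered : ∀ e → proj₁ (edge e) < proj₂ (edge e)
    edge-inj     : Injective _≡_ _≡_ edge
open SimpleGraph public

_∈ₑ_ : {G : SimpleGraph} → Fin (n G) → Fin (m G) → Set
_∈ₑ_ {G} x e = (x ≡ proj₁ (edge G e)) Data.Sum.⊎ (x ≡ proj₂ (edge G e))
  where import Data.Sum

Adjacent : (G : SimpleGraph) → Fin (m G) → Fin (m G) → Set
Adjacent G e f = ∃ λ (x : Fin (n G)) → _∈ₑ_ {G} x e × _∈ₑ_ {G} x f

EdgeColouring : SimpleGraph → ℕ → Set
EdgeColouring G k = Fin (m G) → Fin k

Proper : (G : SimpleGraph) {k : ℕ} → EdgeColouring G k → Set
Proper G col = ∀ e f → e ≢ f → Adjacent G e f → col e ≢ col f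

classSize : (G : SimpleGraph) {k : ℕ} → EdgeColouring G k → Fin k → ℕ
classSize G col c = count (_≟ c) (tabulate col)

record RainbowMatching (G : SimpleGraph) {k : ℕ} (col : EdgeColouring G k) (s : ℕ) : Set where
  field
    pick     : Fin s → Fin (m G)
    distinct : Injective _≡_ _≡_ pick
    disjoint : ∀ i j → i ≢ j → ¬ Adjacent G (pick i) (pick j)
    rainbow  : ∀ i j → i ≢ j → col (pick i) ≢ col (pick j)

-- Take the complete bipartite graph on two copies A, B of ℤ/t and colour the edge a — b by
-- b − a (the cyclic Latin square), then add one more colour class: a perfect matching
-- inside A together with one inside B.  A rainbow matching of size t covers all 2t vertices.
-- If it uses the extra colour, its other t − 1 edges cover t − 1 vertices of A, while the
-- extra edge covers 0 or 2 of them, never the one remaining vertex.  Otherwise it is a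
-- transversal of the Latin square: a_i + c_i ≡ b_i (mod t) with (a_i), (b_i), (c_i) all
-- permutations of ℤ/t, and summing over i gives t ∣ 0 + 1 + ⋯ + (t − 1) = t(t − 1)/2,
-- which fails for even t.
module Submission where

open import Defs

open import Data.Nat.Properties using (+-*-semiring)
open import Algebra.Properties.Semiring.Sum +-*-semiring
  using (sum; ∑-distrib-+; sum-remove; sum-cong-≗; *-distribˡ-sum; *-distribʳ-sum)
open import Data.Bool.Base using (true; false; if_then_else_)
open import Data.Empty using (⊥)
open import Data.Fin.Base as Fin
  using (Fin; zero; suc; toℕ; fromℕ<; _↑ˡ_; _↑ʳ_; splitAt; join; combine; remQuot; quotient; remainder;
         punchIn; punchOut)
open import Data.Fin.Properties
  using (toℕ-injective; toℕ-fromℕ<; toℕ<n; toℕ-↑ˡ; toℕ-↑ʳ; ↑ˡ-injective; ↑ʳ-injective; splitAt-↑ˡ;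
         splitAt-↑ʳ; join-splitAt; remQuot-combine; combine-remQuot; <⇒≢; punchIn-punchOut;
         punchOut-injective; punchInᵢ≢i; any?)
  renaming (_≟_ to _≟ᶠ_)
open import Data.Nat.Base using (ℕ; zero; suc; _+_; _*_; _<_; _>_; NonZero)
open import Data.Nat.DivMod using (_%_; _/_; m%n<n; m≡m%n+[m/n]*n; %-distribˡ-+; %-remove-+ˡ; m<n⇒m%n≡m)
open import Data.Nat.Divisibility using (_∣_; divides; n∣m*n)
import Data.Nat.Properties as ℕ
open import Data.Nat.Properties
  using (+-comm; +-assoc; *-suc; *-zeroʳ; *-identityʳ; +-cancelˡ-≡; +-cancelʳ-≡; *-cancelˡ-≡; even≢odd;
         m≤m+n)
open import Data.Nat.Tactic.RingSolver using (solve-∀)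
open import Data.Product.Base using (_×_; _,_; proj₁; proj₂; Σ; uncurry)
import Data.Sum.Base as Sum
open import Data.Sum.Base using (_⊎_; inj₁; inj₂; [_,_]′)
open import Data.Sum.Properties using (inj₁-injective; inj₂-injective)
open import Data.Vec.Base using (count; tabulate)
open import Function.Base using (_∘_; const; id)
open import Function.Definitions using (Injective)
open import Relation.Binary.PropositionalEquality
open import Relation.Nullary using (¬_; Dec; yes; no; does; contradiction)

remQuot-injective : ∀ {m} n → Injective _≡_ _≡_ (remQuot {m} n)
remQuot-injective {m} n {e} {f} eq = begin
  e                                   ≡⟨ combine-remQuot {m} n e ⟨
  uncurry combine (remQuot {m} n e)   ≡⟨ cong (uncurry combine) eq ⟩
  uncurry combine (remQuot {m} n f)   ≡⟨ combine-remQuot {m} n f ⟩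
  f                                   ∎
  where open ≡-Reasoning

↑ˡ<↑ʳ : ∀ {m n} (i : Fin m) (j : Fin n) → toℕ (i ↑ˡ n) < toℕ (m ↑ʳ j)
↑ˡ<↑ʳ {m} {n} i j = begin-strict
  toℕ (i ↑ˡ n)   ≡⟨ toℕ-↑ˡ i n ⟩
  toℕ i          <⟨ toℕ<n i ⟩
  m              ≤⟨ m≤m+n m (toℕ j) ⟩
  m + toℕ j      ≡⟨ toℕ-↑ʳ m j ⟨
  toℕ (m ↑ʳ j)   ∎
  where open ℕ.≤-Reasoning

sum-const : ∀ n x → sum {n} (const x) ≡ n * x
sum-const zero    x = refl
sum-const (suc n) x = cong (x +_) (sum-const n x)

sum-↑ : ∀ m {n} (f : Fin (m + n) → ℕ) → sum f ≡ sum (f ∘ (_↑ˡ n)) + sum (f ∘ (m ↑ʳ_))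
sum-↑ zero    f = refl
sum-↑ (suc m) f = trans (cong (f zero +_) (sum-↑ m (f ∘ suc))) (sym (+-assoc (f zero) _ _))

sum-combine : ∀ m {n} (f : Fin (m * n) → ℕ) → sum f ≡ sum {m} (λ i → sum {n} (λ j → f (combine i j)))
sum-combine zero        f = refl
sum-combine (suc m) {n} f =
  trans (sum-↑ n f) (cong (sum (f ∘ (_↑ˡ (m * n))) +_) (sum-combine m (f ∘ (n ↑ʳ_))))

sum-injective : ∀ {m n} (g : Fin n → ℕ) {f : Fin m → Fin n} →
                Injective _≡_ _≡_ f → m ≡ n → sum (g ∘ f) ≡ sum g
sum-injective {zero}  {zero}  g         f-inj m≡n = refl
sum-injective {suc m} {suc n} g {f = f} f-inj m≡n = begin
  g (f zero) + sum (g ∘ f ∘ suc)                ≡⟨ cong (g (f zero) +_) (sum-cong-≗ (cong g ∘ sym ∘ punchIn-punchOut ∘ f₀≢fsuc)) ⟩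
  g (f zero) + sum (g ∘ punchIn (f zero) ∘ f′)   ≡⟨ cong (g (f zero) +_) (sum-injective (g ∘ punchIn (f zero)) f′-inj (ℕ.suc-injective m≡n)) ⟩
  g (f zero) + sum (g ∘ punchIn (f zero))       ≡⟨ sum-remove g ⟨
  sum g                                         ∎
  where
  open ≡-Reasoning
  f₀≢fsuc : ∀ i → f zero ≢ f (suc i)
  f₀≢fsuc i eq with f-inj eq
  ... | ()
  f′ : Fin m → Fin n
  f′ i = punchOut (f₀≢fsuc i)
  f′-inj : Injective _≡_ _≡_ f′
  f′-inj eq = Data.Fin.Properties.suc-injective (f-inj (punchOut-injective (f₀≢fsuc _) (f₀≢fsuc _) eq))

sum≡n∧rest≡1⇒≡1 : ∀ {n} (f : Fin n → ℕ) i → (∀ j → j ≢ i → f j ≡ 1) → sum f ≡ n → f i ≡ 1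
sum≡n∧rest≡1⇒≡1 {suc n} f i rest≡1 sum≡n = +-cancelʳ-≡ n (f i) 1 (begin
  f i + n                     ≡⟨ cong (f i +_) (trans (sum-const n 1) (*-identityʳ n)) ⟨
  f i + sum {n} (const 1)     ≡⟨ cong (f i +_) (sum-cong-≗ (λ j → rest≡1 (punchIn i j) (punchInᵢ≢i i j))) ⟨
  f i + sum (f ∘ punchIn i)   ≡⟨ sum-remove {i = i} f ⟨
  sum f                       ≡⟨ sum≡n ⟩
  suc n                       ∎)
  where open ≡-Reasoning

sum-toℕ : ∀ n → 2 * sum {n} toℕ + n ≡ n * n
sum-toℕ zero    = refl
sum-toℕ (suc n) = begin
  2 * sum (suc ∘ toℕ {n}) + suc n       ≡⟨ cong (λ s → 2 * s + suc n) (∑-distrib-+ (const 1) (toℕ {n})) ⟩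
  2 * (sum {n} (const 1) + S) + suc n   ≡⟨ cong (λ s → 2 * (s + S) + suc n) (trans (sum-const n 1) (*-identityʳ n)) ⟩
  2 * (n + S) + suc n                   ≡⟨ regroup n S ⟩
  (2 * S + n) + (2 * n + 1)             ≡⟨ cong (_+ (2 * n + 1)) (sum-toℕ n) ⟩
  n * n + (2 * n + 1)                   ≡⟨ square n ⟩
  suc n * suc n                         ∎
  where
  open ≡-Reasoning
  S = sum {n} toℕ
  regroup : ∀ n S → 2 * (n + S) + suc n ≡ (2 * S + n) + (2 * n + 1)
  regroup = solve-∀
  square : ∀ n → n * n + (2 * n + 1) ≡ suc n * suc n
  square = solve-∀

indicator : ∀ {p} {P : Set p} → Dec P → ℕ
indicator d = if does d then 1 else 0

indicator-yes : ∀ {p} {P : Set p} (d : Dec P) → P → indicator d ≡ 1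
indicator-yes (yes _) _ = refl
indicator-yes (no ¬p) p = contradiction p ¬p

indicator-no : ∀ {p} {P : Set p} (d : Dec P) → ¬ P → indicator d ≡ 0
indicator-no (yes p) ¬p = contradiction p ¬p
indicator-no (no _)  _  = refl

count-tabulate : ∀ {a p n} {A : Set a} {P : A → Set p} (P? : ∀ x → Dec (P x)) (f : Fin n → A) →
                 count P? (tabulate f) ≡ sum (λ i → indicator (P? (f i)))
count-tabulate {n = zero}  P? f = refl
count-tabulate {n = suc n} P? f with does (P? (f zero))
... | true  = cong suc (count-tabulate P? (f ∘ suc))
... | false = count-tabulate P? (f ∘ suc)

sum-indicator-≟ : ∀ {n} (c : Fin n) → sum (λ i → indicator (i ≟ᶠ c)) ≡ 1
sum-indicator-≟ {suc n} c = begin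
  sum (λ i → indicator (i ≟ᶠ c))                                ≡⟨ sum-remove {i = c} (λ i → indicator (i ≟ᶠ c)) ⟩
  indicator (c ≟ᶠ c) + sum (λ i → indicator (punchIn c i ≟ᶠ c))  ≡⟨ cong₂ _+_ (indicator-yes (c ≟ᶠ c) refl)
                                                                     (sum-cong-≗ (λ i → indicator-no (punchIn c i ≟ᶠ c) (punchInᵢ≢i c i))) ⟩
  1 + sum {n} (const 0)                                        ≡⟨ cong suc (trans (sum-const n 0) (*-zeroʳ n)) ⟩
  1                                                            ∎
  where open ≡-Reasoning

count-quotient : ∀ m n (c : Fin m) → count (_≟ᶠ c) (tabulate (quotient {m} n)) ≡ n
count-quotient m n c = begin
  count (_≟ᶠ c) (tabulate (quotient {m} n))                                    ≡⟨ count-tabulate (_≟ᶠ c) (quotient {m} n) ⟩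
  sum (λ e → indicator (quotient {m} n e ≟ᶠ c))                                 ≡⟨ sum-combine m {n} (λ e → indicator (quotient {m} n e ≟ᶠ c)) ⟩
  sum {m} (λ i → sum {n} (λ j → indicator (quotient {m} n (combine i j) ≟ᶠ c)))  ≡⟨ sum-cong-≗ (λ i → sum-cong-≗ (λ j →
                                                                                   cong (λ p → indicator (proj₁ p ≟ᶠ c)) (remQuot-combine {m} {n} i j))) ⟩
  sum {m} (λ i → sum {n} (const (indicator (i ≟ᶠ c))))                          ≡⟨ sum-cong-≗ (λ i → sum-const n (indicator (i ≟ᶠ c))) ⟩
  sum {m} (λ i → n * indicator (i ≟ᶠ c))                                        ≡⟨ *-distribˡ-sum n (λ i → indicator (i ≟ᶠ c)) ⟨
  n * sum {m} (λ i → indicator (i ≟ᶠ c))                                        ≡⟨ cong (n *_) (sum-indicator-≟ c) ⟩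
  n * 1                                                                       ≡⟨ *-identityʳ n ⟩
  n                                                                           ∎
  where open ≡-Reasoning

m+n≢0 : ∀ m n .{{_ : NonZero m}} → NonZero (m + n)
m+n≢0 (suc m) n = _

%-cancelˡ-+ : ∀ a {m k d} .{{_ : NonZero d}} → (a + m) % d ≡ (a + k) % d → m % d ≡ k % d
%-cancelˡ-+ a {m} {k} {d@(suc d′)} eq = begin
  m % d                            ≡⟨ unshift m ⟩
  (a * d′ % d + (a + m) % d) % d   ≡⟨ cong (λ r → (a * d′ % d + r) % d) eq ⟩
  (a * d′ % d + (a + k) % d) % d   ≡⟨ unshift k ⟨
  k % d                            ∎
  where
  open ≡-Reasoning
  regroup : ∀ a b x → a + b + x ≡ b + (a + x)
  regroup = solve-∀
  unshift : ∀ x → x % d ≡ (a * d′ % d + (a + x) % d) % d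
  unshift x = begin
    x % d                            ≡⟨ %-remove-+ˡ x (n∣m*n a) ⟨
    (a * d + x) % d                  ≡⟨ cong (λ y → (y + x) % d) (*-suc a d′) ⟩
    (a + a * d′ + x) % d             ≡⟨ cong (_% d) (regroup a (a * d′) x) ⟩
    (a * d′ + (a + x)) % d           ≡⟨ %-distribˡ-+ (a * d′) (a + x) d ⟩
    (a * d′ % d + (a + x) % d) % d   ∎

even∤sum-toℕ : ∀ h .{{_ : NonZero h}} → ¬ (h + h) ∣ sum {h + h} toℕ
even∤sum-toℕ h (divides q S≡q*t) = even≢odd h q (sym (trans 1+2q≡t (double h)))
  where
  instance _ = m+n≢0 h h
  t = h + h
  factor : ∀ t q → t * suc (2 * q) ≡ 2 * (q * t) + t
  factor = solve-∀
  double : ∀ h → h + h ≡ 2 * h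
  double = solve-∀
  1+2q≡t : suc (2 * q) ≡ t
  1+2q≡t = *-cancelˡ-≡ (suc (2 * q)) t t (begin
    t * suc (2 * q)       ≡⟨ factor t q ⟩
    2 * (q * t) + t       ≡⟨ cong (λ s → 2 * s + t) S≡q*t ⟨
    2 * sum {t} toℕ + t   ≡⟨ sum-toℕ t ⟩
    t * t                 ∎)
    where open ≡-Reasoning

module Cyclic {n} .{{_ : NonZero n}} where

  infixl 6 _⊕_
  _⊕_ : Fin n → Fin n → Fin n
  i ⊕ j = fromℕ< (m%n<n (toℕ i + toℕ j) n)

  ⊕-comm : ∀ i j → i ⊕ j ≡ j ⊕ i
  ⊕-comm i j = toℕ-injective (begin
    toℕ (i ⊕ j)           ≡⟨ toℕ-fromℕ< _ ⟩
    (toℕ i + toℕ j) % n   ≡⟨ cong (_% n) (+-comm (toℕ i) (toℕ j)) ⟩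
    (toℕ j + toℕ i) % n   ≡⟨ toℕ-fromℕ< _ ⟨
    toℕ (j ⊕ i)           ∎)
    where open ≡-Reasoning

  ⊕-carry : ∀ i j → toℕ i + toℕ j ≡ toℕ (i ⊕ j) + (toℕ i + toℕ j) / n * n
  ⊕-carry i j = trans (m≡m%n+[m/n]*n (toℕ i + toℕ j) n)
                      (cong (_+ (toℕ i + toℕ j) / n * n) (sym (toℕ-fromℕ< (m%n<n (toℕ i + toℕ j) n))))

  ⊕-cancelˡ : ∀ i {j k} → i ⊕ j ≡ i ⊕ k → j ≡ k
  ⊕-cancelˡ i {j} {k} eq = toℕ-injective (begin
    toℕ j       ≡⟨ m<n⇒m%n≡m (toℕ<n j) ⟨
    toℕ j % n   ≡⟨ %-cancelˡ-+ (toℕ i) (begin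
      (toℕ i + toℕ j) % n   ≡⟨ toℕ-fromℕ< _ ⟨
      toℕ (i ⊕ j)           ≡⟨ cong toℕ eq ⟩
      toℕ (i ⊕ k)           ≡⟨ toℕ-fromℕ< _ ⟩
      (toℕ i + toℕ k) % n   ∎) ⟩
    toℕ k % n   ≡⟨ m<n⇒m%n≡m (toℕ<n k) ⟩
    toℕ k       ∎)
    where open ≡-Reasoning

  ⊕-cancelʳ : ∀ i {j k} → j ⊕ i ≡ k ⊕ i → j ≡ k
  ⊕-cancelʳ i {j} {k} eq = ⊕-cancelˡ i (trans (⊕-comm i j) (trans eq (⊕-comm k i)))

  transversal⇒∣sum-toℕ : {a c : Fin n → Fin n} → Injective _≡_ _≡_ a → Injective _≡_ _≡_ c →
                         Injective _≡_ _≡_ (λ i → a i ⊕ c i) → n ∣ sum {n} toℕ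
  transversal⇒∣sum-toℕ {a} {c} a-inj c-inj b-inj =
    divides (sum carry) (+-cancelˡ-≡ S S (sum carry * n) (begin
      S + S                                         ≡⟨ cong₂ _+_ (sum-injective toℕ a-inj refl) (sum-injective toℕ c-inj refl) ⟨
      sum (toℕ ∘ a) + sum (toℕ ∘ c)                 ≡⟨ ∑-distrib-+ (toℕ ∘ a) (toℕ ∘ c) ⟨
      sum (λ i → toℕ (a i) + toℕ (c i))             ≡⟨ sum-cong-≗ (λ i → ⊕-carry (a i) (c i)) ⟩
      sum (λ i → toℕ (a i ⊕ c i) + carry i * n)     ≡⟨ ∑-distrib-+ (λ i → toℕ (a i ⊕ c i)) (λ i → carry i * n) ⟩
      sum (λ i → toℕ (a i ⊕ c i)) + sum (λ i → carry i * n)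
                                                    ≡⟨ cong₂ _+_ (sum-injective toℕ b-inj refl) (sym (*-distribʳ-sum n carry)) ⟩
      S + sum carry * n                             ∎))
    where
    open ≡-Reasoning
    S = sum {n} toℕ
    carry : Fin n → ℕ
    carry i = (toℕ (a i) + toℕ (c i)) / n

module _ {G : SimpleGraph} {k} {col : EdgeColouring G k} {s} (M : RainbowMatching G col s) where
  open RainbowMatching M

  shared-endpoint⇒≡ : ∀ {i j x} → _∈ₑ_ {G} x (pick i) → _∈ₑ_ {G} x (pick j) → i ≡ j
  shared-endpoint⇒≡ {i} {j} {x} x∈i x∈j with i ≟ᶠ j
  ... | yes i≡j = i≡j
  ... | no  i≢j = contradiction (x , x∈i , x∈j) (disjoint i j i≢j)

  colour-injective : Injective _≡_ _≡_ (col ∘ pick)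
  colour-injective {i} {j} same-colour with i ≟ᶠ j
  ... | yes i≡j = i≡j
  ... | no  i≢j = contradiction same-colour (rainbow i j i≢j)

  endpoint : Fin s ⊎ Fin s → Fin (n G)
  endpoint = [ proj₁ ∘ edge G ∘ pick , proj₂ ∘ edge G ∘ pick ]′

  endpoint-injective : Injective _≡_ _≡_ endpoint
  endpoint-injective {inj₁ i} {inj₁ j} eq = cong inj₁ (shared-endpoint⇒≡ (inj₁ refl) (inj₁ eq))
  endpoint-injective {inj₂ i} {inj₂ j} eq = cong inj₂ (shared-endpoint⇒≡ (inj₂ refl) (inj₂ eq))
  endpoint-injective {inj₁ i} {inj₂ j} eq with shared-endpoint⇒≡ (inj₁ refl) (inj₂ eq)
  ... | refl = contradiction eq (<⇒≢ (edge-ordered G (pick i)))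
  endpoint-injective {inj₂ i} {inj₁ j} eq with shared-endpoint⇒≡ (inj₂ refl) (inj₁ eq)
  ... | refl = contradiction (sym eq) (<⇒≢ (edge-ordered G (pick i)))

  sum-endpoints : s + s ≡ n G → (w : Fin (n G) → ℕ) →
                  sum (λ i → w (endpoint (inj₁ i)) + w (endpoint (inj₂ i))) ≡ sum w
  sum-endpoints s+s≡n w = begin
    sum (λ i → w (endpoint (inj₁ i)) + w (endpoint (inj₂ i)))   ≡⟨ ∑-distrib-+ (w ∘ endpoint ∘ inj₁) (w ∘ endpoint ∘ inj₂) ⟩
    sum (w ∘ endpoint ∘ inj₁) + sum (w ∘ endpoint ∘ inj₂)       ≡⟨ cong₂ _+_ (sum-cong-≗ (λ i → cong (w ∘ endpoint) (splitAt-↑ˡ s i s)))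
                                                                            (sum-cong-≗ (λ i → cong (w ∘ endpoint) (splitAt-↑ʳ s s i))) ⟨
    sum (w ∘ endpoint′ ∘ (_↑ˡ s)) + sum (w ∘ endpoint′ ∘ (s ↑ʳ_)) ≡⟨ sum-↑ s (w ∘ endpoint′) ⟨
    sum (w ∘ endpoint′)                                        ≡⟨ sum-injective w endpoint′-injective s+s≡n ⟩
    sum w                                                      ∎
    where
    open ≡-Reasoning
    endpoint′ : Fin (s + s) → Fin (n G)
    endpoint′ = endpoint ∘ splitAt s
    endpoint′-injective : Injective _≡_ _≡_ endpoint′
    endpoint′-injective {x} {y} eq = begin
      x                        ≡⟨ join-splitAt s s x ⟨
      join s s (splitAt s x)   ≡⟨ cong (join s s) (endpoint-injective {splitAt s x} {splitAt s y} eq) ⟩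
      join s s (splitAt s y)   ≡⟨ join-splitAt s s y ⟩
      y                        ∎

-- The construction

module Construction (h : ℕ) .{{_ : NonZero h}} where

  t : ℕ
  t = h + h

  instance
    t≢0 : NonZero t
    t≢0 = m+n≢0 h h

  open Cyclic {t}

  Vertex : Set
  Vertex = Fin (t + t)

  left right : Fin t → Vertex
  left  a = a ↑ˡ t
  right b = t ↑ʳ b

  _∈ᵖ_ : Vertex → Vertex × Vertex → Set
  x ∈ᵖ p = x ≡ proj₁ p ⊎ x ≡ proj₂ p

  rung : (Fin t → Vertex) → Fin h → Vertex × Vertex
  rung side j = side (j ↑ˡ h) , side (h ↑ʳ j)

  -- The edge with index (c , k) has colour c.  Colour 0 is the matching j — h + j inside each
  -- side, and colour c + 1 is the matching a — a + c (mod t) from A to B.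
  arc : Fin (suc t) × Fin t → Vertex × Vertex
  arc (zero  , k) = [ rung left , rung right ]′ (splitAt h k)
  arc (suc c , a) = left a , right (a ⊕ c)

  left≢right : ∀ a b → left a ≢ right b
  left≢right a b eq with trans (sym (splitAt-↑ˡ t a t)) (trans (cong (splitAt t) eq) (splitAt-↑ʳ t t b))
  ... | ()

  isLeft : Vertex → ℕ
  isLeft x = [ const 1 , const 0 ]′ (splitAt t x)

  isLeft-left : ∀ a → isLeft (left a) ≡ 1
  isLeft-left a = cong [ const 1 , const 0 ]′ (splitAt-↑ˡ t a t)

  isLeft-right : ∀ b → isLeft (right b) ≡ 0
  isLeft-right b = cong [ const 1 , const 0 ]′ (splitAt-↑ʳ t t b)

  sum-isLeft : sum isLeft ≡ t
  sum-isLeft = begin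
    sum isLeft                                   ≡⟨ sum-↑ t isLeft ⟩
    sum (isLeft ∘ left) + sum (isLeft ∘ right)   ≡⟨ cong₂ _+_ (sum-cong-≗ isLeft-left) (sum-cong-≗ isLeft-right) ⟩
    sum {t} (const 1) + sum {t} (const 0)        ≡⟨ cong₂ _+_ (sum-const t 1) (sum-const t 0) ⟩
    t * 1 + t * 0                                ≡⟨ simplify t ⟩
    t                                            ∎
    where
    open ≡-Reasoning
    simplify : ∀ t → t * 1 + t * 0 ≡ t
    simplify = solve-∀

  leftCount : Vertex × Vertex → ℕ
  leftCount (x , y) = isLeft x + isLeft y

  leftCount-cross : ∀ c a → leftCount (arc (suc c , a)) ≡ 1
  leftCount-cross c a = cong₂ _+_ (isLeft-left a) (isLeft-right (a ⊕ c))

  leftCount-rung : ∀ k → leftCount (arc (zero , k)) ≢ 1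
  leftCount-rung k with splitAt h k
  ... | inj₁ j = λ 2≡1 → contradiction (trans (sym (cong₂ _+_ (isLeft-left _) (isLeft-left _))) 2≡1) λ ()
  ... | inj₂ j = λ 0≡1 → contradiction (trans (sym (cong₂ _+_ (isLeft-right _) (isLeft-right _))) 0≡1) λ ()

  arc-ordered : ∀ p → proj₁ (arc p) Fin.< proj₂ (arc p)
  arc-ordered (zero  , k) with splitAt h k
  ... | inj₁ j = begin-strict
    toℕ (left (j ↑ˡ h))    ≡⟨ toℕ-↑ˡ (j ↑ˡ h) t ⟩
    toℕ (j ↑ˡ h)           <⟨ ↑ˡ<↑ʳ j j ⟩
    toℕ (h ↑ʳ j)           ≡⟨ toℕ-↑ˡ (h ↑ʳ j) t ⟨
    toℕ (left (h ↑ʳ j))    ∎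
    where open ℕ.≤-Reasoning
  ... | inj₂ j = begin-strict
    toℕ (right (j ↑ˡ h))   ≡⟨ toℕ-↑ʳ t (j ↑ˡ h) ⟩
    t + toℕ (j ↑ˡ h)       <⟨ ℕ.+-monoʳ-< t (↑ˡ<↑ʳ j j) ⟩
    t + toℕ (h ↑ʳ j)       ≡⟨ toℕ-↑ʳ t (h ↑ʳ j) ⟨
    toℕ (right (h ↑ʳ j))   ∎
    where open ℕ.≤-Reasoning
  arc-ordered (suc c , a) = ↑ˡ<↑ʳ a (a ⊕ c)

  half : Fin t → Fin h
  half y = [ id , id ]′ (splitAt h y)

  rungIndex : Vertex → Fin t
  rungIndex x = join h h (Sum.map half half (splitAt t x))

  rungIndex-∈ : ∀ k {x} → x ∈ᵖ arc (zero , k) → rungIndex x ≡ k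
  rungIndex-∈ k x∈ = trans (cong (join h h) (side-half (splitAt h k) x∈)) (join-splitAt h h k)
    where
    side-half : ∀ s {x} → x ∈ᵖ [ rung left , rung right ]′ s → Sum.map half half (splitAt t x) ≡ s
    side-half (inj₁ j) (inj₁ refl) rewrite splitAt-↑ˡ t (j ↑ˡ h) t | splitAt-↑ˡ h j h = refl
    side-half (inj₁ j) (inj₂ refl) rewrite splitAt-↑ˡ t (h ↑ʳ j) t | splitAt-↑ʳ h h j = refl
    side-half (inj₂ j) (inj₁ refl) rewrite splitAt-↑ʳ t t (j ↑ˡ h) | splitAt-↑ˡ h j h = refl
    side-half (inj₂ j) (inj₂ refl) rewrite splitAt-↑ʳ t t (h ↑ʳ j) | splitAt-↑ʳ h h j = refl

  arc-class-matching : ∀ c {a a′ x} → x ∈ᵖ arc (c , a) → x ∈ᵖ arc (c , a′) → a ≡ a′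
  arc-class-matching zero {a} {a′} x∈a x∈a′ = trans (sym (rungIndex-∈ a x∈a)) (rungIndex-∈ a′ x∈a′)
  arc-class-matching (suc c) (inj₁ refl) (inj₁ eq) = ↑ˡ-injective t _ _ eq
  arc-class-matching (suc c) (inj₁ refl) (inj₂ eq) = contradiction eq (left≢right _ _)
  arc-class-matching (suc c) (inj₂ refl) (inj₁ eq) = contradiction (sym eq) (left≢right _ _)
  arc-class-matching (suc c) (inj₂ refl) (inj₂ eq) = ⊕-cancelʳ c (↑ʳ-injective t _ _ eq)

  arc-injective : Injective _≡_ _≡_ arc
  arc-injective {zero  , k} {zero   , k′} eq =
    cong (zero ,_) (arc-class-matching zero (inj₁ refl) (inj₁ (cong proj₁ eq)))
  arc-injective {zero  , k} {suc c′ , a′} eq =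
    contradiction (trans (cong leftCount eq) (leftCount-cross c′ a′)) (leftCount-rung k)
  arc-injective {suc c , a} {zero   , k′} eq =
    contradiction (trans (cong leftCount (sym eq)) (leftCount-cross c a)) (leftCount-rung k′)
  arc-injective {suc c , a} {suc c′ , a′} eq with ↑ˡ-injective t a a′ (cong proj₁ eq)
  ... | refl = cong (λ c → suc c , a) (⊕-cancelˡ a (↑ʳ-injective t _ _ (cong proj₂ eq)))

  G : SimpleGraph
  G = record
    { n            = t + t
    ; m            = suc t * t
    ; edge         = arc ∘ remQuot t
    ; edge-ordered = arc-ordered ∘ remQuot t
    ; edge-inj     = remQuot-injective t ∘ arc-injective
    }

  colour : EdgeColouring G (suc t)
  colour = quotient t

  colour-proper : Proper G colour
  colour-proper e f e≢f (x , x∈e , x∈f) same-colour =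
    e≢f (remQuot-injective t (cong₂ _,_ same-colour (arc-class-matching (colour f) x∈e′ x∈f)))
    where
    x∈e′ : x ∈ᵖ arc (colour f , remainder t e)
    x∈e′ = subst (λ c → x ∈ᵖ arc (c , remainder t e)) same-colour x∈e

  colour-classSize : ∀ c → classSize G colour c ≡ t
  colour-classSize = count-quotient (suc t) t

  cross-edge : ∀ e (0≢c : zero ≢ colour e) → edge G e ≡ arc (suc (punchOut 0≢c) , remainder t e)
  cross-edge e 0≢c = cong (λ c → arc (c , remainder t e)) (sym (punchIn-punchOut 0≢c))

  module _ (M : RainbowMatching G colour t) where
    open RainbowMatching M

    no-rung : ∀ i → zero ≢ colour (pick i)
    no-rung i₀ 0≡c = leftCount-rung (remainder t (pick i₀)) (begin
      leftCount (arc (zero , remainder t (pick i₀)))   ≡⟨ cong (λ c → leftCount (arc (c , remainder t (pick i₀)))) 0≡c ⟩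
      leftCount (edge G (pick i₀))                      ≡⟨ sum≡n∧rest≡1⇒≡1 (leftCount ∘ edge G ∘ pick) i₀ rest≡1 total ⟩
      1                                                 ∎)
      where
      open ≡-Reasoning
      rest≡1 : ∀ j → j ≢ i₀ → leftCount (edge G (pick j)) ≡ 1
      rest≡1 j j≢i₀ = trans (cong leftCount (cross-edge (pick j) 0≢c)) (leftCount-cross _ _)
        where
        0≢c : zero ≢ colour (pick j)
        0≢c 0≡c′ = rainbow j i₀ j≢i₀ (trans (sym 0≡c′) 0≡c)
      total : sum (leftCount ∘ edge G ∘ pick) ≡ t
      total = trans (sum-endpoints M refl isLeft) sum-isLeft

    no-cross-transversal : (∀ i → zero ≢ colour (pick i)) → ⊥
    no-cross-transversal 0≢c = even∤sum-toℕ h (transversal⇒∣sum-toℕ a-injective c-injective b-injective)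
      where
      open ≡-Reasoning
      a c b : Fin t → Fin t
      a i = remainder t (pick i)
      c i = punchOut (0≢c i)
      b i = a i ⊕ c i
      edge≡ : ∀ i → edge G (pick i) ≡ (left (a i) , right (b i))
      edge≡ i = cross-edge (pick i) (0≢c i)
      a-injective : Injective _≡_ _≡_ a
      a-injective {i} {j} eq = inj₁-injective (endpoint-injective M (begin
        endpoint M (inj₁ i)   ≡⟨ cong proj₁ (edge≡ i) ⟩
        left (a i)            ≡⟨ cong left eq ⟩
        left (a j)            ≡⟨ cong proj₁ (edge≡ j) ⟨
        endpoint M (inj₁ j)   ∎))
      b-injective : Injective _≡_ _≡_ b
      b-injective {i} {j} eq = inj₂-injective (endpoint-injective M (begin
        endpoint M (inj₂ i)   ≡⟨ cong proj₂ (edge≡ i) ⟩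
        right (b i)           ≡⟨ cong right eq ⟩
        right (b j)           ≡⟨ cong proj₂ (edge≡ j) ⟨
        endpoint M (inj₂ j)   ∎))
      c-injective : Injective _≡_ _≡_ c
      c-injective eq = colour-injective M (punchOut-injective (0≢c _) (0≢c _) eq)

  no-rainbow-matching : ¬ RainbowMatching G colour t
  no-rainbow-matching M with any? (λ i → zero ≟ᶠ colour (RainbowMatching.pick M i))
  ... | yes (i , 0≡c) = no-rung M i 0≡c
  ... | no  none      = no-cross-transversal M (λ i 0≡c → none (i , 0≡c))

Counterexample : ℕ → Set
Counterexample t = Σ SimpleGraph λ G → Σ (EdgeColouring G (suc t)) λ col →
  Proper G col × (∀ c → classSize G col c ≡ t) × ¬ RainbowMatching G col t

counterexample : ∀ h .{{_ : NonZero h}} → Counterexample (h + h)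
counterexample h = G , colour , colour-proper , colour-classSize , no-rainbow-matching
  where open Construction h

proposition1p10 : (t : ℕ) → t > 0 → 2 ∣ t →
    Σ SimpleGraph λ G → Σ (EdgeColouring G (suc t)) λ col →
      Proper G col × (∀ c → classSize G col c ≡ t) × ¬ RainbowMatching G col t
proposition1p10 _ () (divides zero refl)
proposition1p10 t _  (divides h@(suc _) t≡h*2) = subst Counterexample (sym t≡h+h) (counterexample h)
  where
  double : ∀ h → h * 2 ≡ h + h
  double = solve-∀
  t≡h+h : t ≡ h + h
  t≡h+h = trans t≡h*2 (double h)
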